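{- Let $F$ be a CNF formula in which no literal occurs more than once. For every literal $l$ occurring in $F$ there exists $t>0$ such that $next^t(l)$ is either $l$ or a pure literal.
   Context: A CNF formula $F=C_1\wedge\cdots\wedge C_m$ is viewed as a sequence of clauses, each a set of literals; literals are coded by natural numbers, and $\overline l$ denotes the complement of $l$. A pure literal is a literal that occurs in $F$ while its complement does not. For literals $l_1,l_2$, $follows(l_1,l_2)$ holds if $l_1,l_2$ belong to the same clause and $l_1$ is the immediate successor of $l_2$ in that clause with respect to the numerical order of codes, cyclically (the smallest literal of the clause follows the largest; a literal alone in its clause follows itself). For a literal $l$ of $F$ that is not pure, $next(l)$ is the literal $l'$ with $follows(l',\overline l)$; for a pure literal, $next(l)=l$. $next^0(l)=l$ and $next^{t+1}(l)=next(next^t(l))$. -}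

module Defs where

open import Data.Nat using (ℕ; zero; suc; _<_; _≤_)
open import Data.Nat.Base using (_%_; _∸_; _+_)
open import Data.List using (List; concat)
open import Data.List.Membership.Propositional using (_∈_)
open import Data.List.Relation.Unary.Unique.Propositional using (Unique)
open import Data.Product using (_×_; ∃-syntax)
open import Data.Sum using (_⊎_)
open import Relation.Nullary using (¬_)
open import Relation.Binary.PropositionalEquality using (_≡_)

-- Literals are coded by natural numbers: variable v has positive literal 2v
-- and negative literal 2v+1. The complement flips the lowest bit.
Literal : Set
Literal = ℕ

comp : Literal → Literal
comp n with n % 2
... | zero  = suc n
... | suc _ = n ∸ 1

Clause : Set
Clause = List Literal

CNF : Set
CNF = List Clause

Occurs : CNF → Literal → Set
Occurs F l = l ∈ concat F

NoRepeatedLiterals : CNF → Set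
NoRepeatedLiterals F = Unique (concat F)

Pure : CNF → Literal → Set
Pure F l = Occurs F l × ¬ Occurs F (comp l)

SuccIn : Clause → Literal → Literal → Set
SuccIn C l₁ l₂ =
  l₁ ∈ C × l₂ ∈ C ×
  ( (l₂ < l₁ × (∀ x → x ∈ C → ¬ (l₂ < x × x < l₁)))
  ⊎ ((∀ x → x ∈ C → x ≤ l₂) × (∀ x → x ∈ C → l₁ ≤ x)) )

Follows : CNF → Literal → Literal → Set
Follows F l₁ l₂ = ∃[ C ] (C ∈ F × SuccIn C l₁ l₂)

-- next as a relation: Next F l l' means next(l) = l'
Next : CNF → Literal → Literal → Set
Next F l l' = (Pure F l × l' ≡ l) ⊎ (¬ Pure F l × Follows F l' (comp l))

data NextPow (F : CNF) : ℕ → Literal → Literal → Set where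
  zero : ∀ {l} → NextPow F 0 l l
  step : ∀ {t l m l'} → NextPow F t l m → Next F m l' → NextPow F (suc t) l l'

-- Without repeated literals a literal lies in exactly one clause, and
-- inside a clause the cyclic successor determines its predecessor; since the
-- complement is an involution, next is injective on the non-pure occurring
-- literals, while it fixes every pure literal.  The orbit of l stays among the
-- finitely many occurring literals, so by pigeonhole it repeats:
-- next^i(l) = next^j(l) with i < j.  Cancelling one application of next at a
-- time (legal while both sides are non-pure) either reaches i = 0, so the orbit
-- returns to l, or meets a pure literal, which next then keeps forever.
module Submission where

open import Defs
open import Data.Nat using (ℕ; _<_)
open import Data.Product using (_×_; ∃-syntax)
open import Data.Sum using (_⊎_)
open import Relation.Binary.PropositionalEquality using (_≡_)

open import Data.Nat using (zero; suc; _≤_; _%_; _<?_; _≟_; z<s; s<s)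
open import Data.Nat.Properties using (≤-antisym; <⇒≱; ≮⇒≥; <-cmp; n<1+n)
open import Data.Nat.GeneralisedArithmetic using (fold)
open import Data.List using (List; []; _∷_; _++_; concat; filter)
open import Data.List.Extrema.Nat using (min; max; argmin-sel; min≤⊤; min≤xs; xs≤max)
open import Data.List.Membership.Propositional using (_∈_)
open import Data.List.Membership.DecPropositional _≟_ using (_∈?_)
open import Data.List.Membership.Propositional.Properties
  using (∈-filter⁺; ∈-filter⁻; ∈-concat⁺′; ∈-concat⁻′)
open import Data.List.Relation.Unary.Any using (here; there)
import Data.List.Relation.Unary.All as All
open import Data.List.Relation.Unary.All.Properties using (++⁻ʳ)
open import Data.List.Relation.Unary.AllPairs using (_∷_)
open import Data.List.Relation.Unary.Unique.Propositional using (Unique)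
open import Data.Fin using (Fin; toℕ; fromℕ<)
open import Data.Fin.Properties using (pigeonhole; toℕ-fromℕ<)
open import Data.Product using (_,_; proj₁; proj₂)
open import Data.Sum using (inj₁; inj₂)
open import Data.Empty using (⊥; ⊥-elim)
open import Relation.Nullary using (¬_; Dec; yes; no)
open import Relation.Binary.Definitions using (tri<; tri≈; tri>)
open import Relation.Binary.PropositionalEquality using (refl; sym; trans; cong; subst; module ≡-Reasoning)

-- Adding 2 to a literal does not change its parity, hence commutes with comp.
comp-suc-suc : ∀ l → comp (suc (suc l)) ≡ suc (suc (comp l))
comp-suc-suc zero = refl
comp-suc-suc (suc l) with suc l % 2
... | zero  = refl
... | suc _ = refl

comp-involutive : ∀ l → comp (comp l) ≡ l
comp-involutive zero = refl
comp-involutive (suc zero) = refl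
comp-involutive (suc (suc l)) = begin
  comp (comp (suc (suc l)))       ≡⟨ cong comp (comp-suc-suc l) ⟩
  comp (suc (suc (comp l)))       ≡⟨ comp-suc-suc (comp l) ⟩
  suc (suc (comp (comp l)))       ≡⟨ cong (λ k → suc (suc k)) (comp-involutive l) ⟩
  suc (suc l)                     ∎
  where open ≡-Reasoning

comp-injective : ∀ {l₁ l₂} → comp l₁ ≡ comp l₂ → l₁ ≡ l₂
comp-injective {l₁} {l₂} e =
  trans (sym (comp-involutive l₁)) (trans (cong comp e) (comp-involutive l₂))

min-∈ : ∀ a xs → min a xs ∈ (a ∷ xs)
min-∈ a xs with argmin-sel (λ x → x) a xs
... | inj₁ e = here e
... | inj₂ p = there p

min-≤ : ∀ {y} a xs → y ∈ (a ∷ xs) → min a xs ≤ y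
min-≤ a xs (here refl) = min≤⊤ a xs
min-≤ a xs (there p)   = All.lookup (min≤xs a xs) p

cyclicSucc : Clause → Literal → Literal
cyclicSucc C x with filter (x <?_) C
... | []     = min x C
... | c ∷ cs = min c cs

cyclicSucc-spec : ∀ C x → x ∈ C → SuccIn C (cyclicSucc C x) x
cyclicSucc-spec C x x∈C with filter (x <?_) C in above
... | [] = wrap (min-∈ x C) , x∈C , inj₂ (below-x , λ y y∈C → min-≤ x C (there y∈C))
  where
  below-x : ∀ y → y ∈ C → y ≤ x
  below-x y y∈C with x <? y
  ... | no  x≮y = ≮⇒≥ x≮y
  ... | yes x<y with subst (y ∈_) above (∈-filter⁺ (x <?_) y∈C x<y)
  ... | ()
  wrap : min x C ∈ (x ∷ C) → min x C ∈ C
  wrap (here e)  = subst (_∈ C) (sym e) x∈C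
  wrap (there p) = p
... | c ∷ cs = proj₁ succ-above , x∈C , inj₁ (proj₂ succ-above , nothing-between)
  where
  succ-above : min c cs ∈ C × x < min c cs
  succ-above = ∈-filter⁻ (x <?_) {xs = C} (subst (min c cs ∈_) (sym above) (min-∈ c cs))
  nothing-between : ∀ y → y ∈ C → ¬ (x < y × y < min c cs)
  nothing-between y y∈C (x<y , y<m) =
    <⇒≱ y<m (min-≤ c cs (subst (y ∈_) above (∈-filter⁺ (x <?_) y∈C x<y)))

succIn-injective : ∀ {C a x y} → SuccIn C a x → SuccIn C a y → x ≡ y
succIn-injective {x = x} {y} (_ , x∈ , inj₁ (x<a , x-gap)) (_ , y∈ , inj₁ (y<a , y-gap))
  with <-cmp x y
... | tri< x<y _ _ = ⊥-elim (x-gap _ y∈ (x<y , y<a))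
... | tri≈ _ x≡y _ = x≡y
... | tri> _ _ y<x = ⊥-elim (y-gap _ x∈ (y<x , x<a))
succIn-injective (_ , x∈ , inj₁ (x<a , _)) (_ , _ , inj₂ (_ , a-least)) = ⊥-elim (<⇒≱ x<a (a-least _ x∈))
succIn-injective (_ , _ , inj₂ (_ , a-least)) (_ , y∈ , inj₁ (y<a , _)) = ⊥-elim (<⇒≱ y<a (a-least _ y∈))
succIn-injective (_ , x∈ , inj₂ (x-max , _)) (_ , y∈ , inj₂ (y-max , _)) = ≤-antisym (y-max _ x∈) (x-max _ y∈)

++-disjoint : ∀ {v : ℕ} xs {ys} → Unique (xs ++ ys) → v ∈ xs → v ∈ ys → ⊥
++-disjoint (x ∷ xs) (x∉ ∷ _) (here refl) v∈ys = All.lookup (++⁻ʳ xs x∉) v∈ys refl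
++-disjoint (x ∷ xs) (_ ∷ u)  (there p)   v∈ys = ++-disjoint xs u p v∈ys

unique-++ʳ : ∀ (xs : List ℕ) {ys} → Unique (xs ++ ys) → Unique ys
unique-++ʳ []       u       = u
unique-++ʳ (x ∷ xs) (_ ∷ u) = unique-++ʳ xs u

clause-unique : ∀ {F a C D} → NoRepeatedLiterals F → C ∈ F → D ∈ F → a ∈ C → a ∈ D → C ≡ D
clause-unique {C ∷ F} u (here refl) (here refl) _   _   = refl
clause-unique {C ∷ F} u (here refl) (there D∈) a∈C a∈D = ⊥-elim (++-disjoint C u a∈C (∈-concat⁺′ a∈D D∈))
clause-unique {C ∷ F} u (there C∈) (here refl) a∈C a∈D = ⊥-elim (++-disjoint C u a∈D (∈-concat⁺′ a∈C C∈))
clause-unique {E ∷ F} u (there C∈) (there D∈) a∈C a∈D = clause-unique (unique-++ʳ E u) C∈ D∈ a∈C a∈D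

follows-injective : ∀ {F a x y} → NoRepeatedLiterals F → Follows F a x → Follows F a y → x ≡ y
follows-injective u (C , C∈ , sx) (D , D∈ , sy) with clause-unique u C∈ D∈ (proj₁ sx) (proj₁ sy)
... | refl = succIn-injective sx sy

next-occurs : ∀ {F l l'} → Occurs F l → Next F l l' → Occurs F l'
next-occurs o (inj₁ (_ , refl))                  = o
next-occurs o (inj₂ (_ , C , C∈ , l'∈C , _ , _)) = ∈-concat⁺′ l'∈C C∈

next-of-pure : ∀ {F l l'} → Pure F l → Next F l l' → l' ≡ l
next-of-pure _ (inj₁ (_ , e))       = e
next-of-pure p (inj₂ (not-pure , _)) = ⊥-elim (not-pure p)

-- Two non-pure literals with the same next have equal complements.
next-injective : ∀ {F l₁ l₂ a} → NoRepeatedLiterals F → ¬ Pure F l₁ → ¬ Pure F l₂ →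
  Next F l₁ a → Next F l₂ a → l₁ ≡ l₂
next-injective u np₁ _   (inj₁ (p₁ , _)) _               = ⊥-elim (np₁ p₁)
next-injective u _   np₂ (inj₂ _)        (inj₁ (p₂ , _)) = ⊥-elim (np₂ p₂)
next-injective u _   _   (inj₂ (_ , f₁)) (inj₂ (_ , f₂)) = comp-injective (follows-injective u f₁ f₂)

pure? : ∀ F l → Dec (Pure F l)
pure? F l with l ∈? concat F | comp l ∈? concat F
... | yes o | no  c = yes (o , c)
... | yes _ | yes c = no (λ p → proj₂ p c)
... | no  o | _     = no (λ p → o (proj₁ p))

next : CNF → Literal → Literal
next F l with comp l ∈? concat F
... | yes c = cyclicSucc (proj₁ (∈-concat⁻′ F c)) (comp l)
... | no  _ = l

next-spec : ∀ F {l} → Occurs F l → Next F l (next F l)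
next-spec F {l} o with comp l ∈? concat F
... | no  c = inj₁ ((o , c) , refl)
... | yes c = inj₂ ((λ p → proj₂ p c) , C , C∈F , cyclicSucc-spec C (comp l) c∈C)
  where
  C = proj₁ (∈-concat⁻′ F c)
  c∈C = proj₁ (proj₂ (∈-concat⁻′ F c))
  C∈F = proj₂ (proj₂ (∈-concat⁻′ F c))

module BoundedOrbits
  {S P : ℕ → Set} (f : ℕ → ℕ) (N : ℕ)
  (closed    : ∀ {x} → S x → S (f x))
  (bounded   : ∀ {x} → S x → x < N)
  (P?        : ∀ x → Dec (P x))
  (P-fixed   : ∀ {x} → P x → f x ≡ x)
  (injective : ∀ {x y} → S x → S y → ¬ P x → ¬ P y → f x ≡ f y → x ≡ y)
  where

  orbit : ℕ → ℕ → ℕ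
  orbit x t = fold x f t

  orbit-closed : ∀ {x} → S x → ∀ t → S (orbit x t)
  orbit-closed s zero    = s
  orbit-closed s (suc t) = closed (orbit-closed s t)

  ReturnsOrHits : ℕ → Set
  ReturnsOrHits x = ∃[ t ] (0 < t × (orbit x t ≡ x ⊎ P (orbit x t)))

  -- Pigeonhole: the first N + 1 points of an orbit inside S < N repeat.
  repetition : ∀ {x} → S x → ∃[ i ] ∃[ j ] (i < j × orbit x i ≡ orbit x j)
  repetition {x} s with pigeonhole (n<1+n N) code
    where
    code : Fin (suc N) → Fin N
    code k = fromℕ< (bounded (orbit-closed s (toℕ k)))
  ... | i , j , i<j , same = toℕ i , toℕ j , i<j , decode same
    where
    decode : fromℕ< (bounded (orbit-closed s (toℕ i))) ≡ fromℕ< (bounded (orbit-closed s (toℕ j))) →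
      orbit x (toℕ i) ≡ orbit x (toℕ j)
    decode e = trans (sym (toℕ-fromℕ< _)) (trans (cong toℕ e) (toℕ-fromℕ< _))

  -- A point of P stays put, so its orbit keeps hitting P.
  hits-P : ∀ {x} t → P (orbit x t) → ReturnsOrHits x
  hits-P t p = suc t , z<s , inj₂ (subst P (sym (P-fixed p)) p)

  -- Cancel f from f^i(x) = f^j(x) until i = 0 or a point of P shows up.
  unwind : ∀ {x} → S x → ∀ i j → i < j → orbit x i ≡ orbit x j → ReturnsOrHits x
  unwind s zero    j       i<j       e = j , i<j , inj₁ (sym e)
  unwind s (suc i) (suc j) (s<s i<j) e with P? (orbit _ i) | P? (orbit _ j)
  ... | yes p  | _      = hits-P i p
  ... | no  _  | yes p  = hits-P j p
  ... | no  ¬p | no  ¬q =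
    unwind s i j i<j (injective (orbit-closed s i) (orbit-closed s j) ¬p ¬q e)

  returns-or-hits : ∀ {x} → S x → ReturnsOrHits x
  returns-or-hits s with repetition s
  ... | i , j , i<j , e = unwind s i j i<j e

next-preserves-occurs : ∀ F {l} → Occurs F l → Occurs F (next F l)
next-preserves-occurs F o = next-occurs o (next-spec F o)

next-fixes-pure : ∀ F {l} → Pure F l → next F l ≡ l
next-fixes-pure F p = next-of-pure p (next-spec F (proj₁ p))

next-injective-off-pure : ∀ F → NoRepeatedLiterals F → ∀ {l₁ l₂} → Occurs F l₁ → Occurs F l₂ →
  ¬ Pure F l₁ → ¬ Pure F l₂ → next F l₁ ≡ next F l₂ → l₁ ≡ l₂
next-injective-off-pure F u {l₂ = l₂} o₁ o₂ np₁ np₂ e =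
  next-injective u np₁ np₂ (next-spec F o₁) (subst (Next F l₂) (sym e) (next-spec F o₂))

occurs-bounded : ∀ F {l} → Occurs F l → l < suc (max 0 (concat F))
occurs-bounded F o = s<s (All.lookup (xs≤max 0 (concat F)) o)

next-path : ∀ F {l} → Occurs F l → ∀ t → Occurs F (fold l (next F) t) × NextPow F t l (fold l (next F) t)
next-path F o zero = o , zero
next-path F o (suc t) with next-path F o t
... | o' , path = next-preserves-occurs F o' , step path (next-spec F o')

mainTheorem9 : (F : CNF) → NoRepeatedLiterals F → (l : Literal) → Occurs F l →
    ∃[ t ] (0 < t × ∃[ l' ] (NextPow F t l l' × (l' ≡ l ⊎ Pure F l')))
mainTheorem9 F u l o = path-of (returns-or-hits o)
  where
  open BoundedOrbits {S = Occurs F} {P = Pure F} (next F) (suc (max 0 (concat F)))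
    (next-preserves-occurs F) (occurs-bounded F) (pure? F)
    (next-fixes-pure F) (next-injective-off-pure F u)
  path-of : ReturnsOrHits l → ∃[ t ] (0 < t × ∃[ l' ] (NextPow F t l l' × (l' ≡ l ⊎ Pure F l')))
  path-of (t , t>0 , closes) = t , t>0 , orbit l t , proj₂ (next-path F o t) , closes
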